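{- Let $L$ be a finite lattice and let $\tilde L$ be as in the context. Let $T'$ be a left-semicontinuous t-norm on $\tilde L$. If the restriction $T'|_L$ of $T'$ to $L\times L$ is a t-norm on $L$, then $T'|_L$ is left-semicontinuous.
   Context: For a lattice $L$ with bottom $0$: an atom is an element covering $0$; $A(L)$ is the set of atoms; $J(L)$ the set of non-zero join-irreducible elements; $H(L)=J(L)\setminus A(L)$. $\tilde L$ is obtained from the finite lattice $L$ by adding, for each $p\in H(L)$, a new distinct element $w_p$ with $0\prec w_p\prec p$ (so $w_p\le x$ for $x\in L$ iff $p\le x$); $\tilde L$ is a finite atomistic lattice containing $L$ as a sublattice with the same $0$ and $1$. A t-norm on a bounded lattice is a binary operation that is monotone in each argument, commutative, associative, with neutral element $1$. A t-norm $T$ on a complete lattice $M$ is left-semicontinuous if $T(a,\bigvee S)=\bigvee_{x\in S}T(a,x)$ for every $a\in M$ and every $S\subseteq M$ with $\bigvee S\ne1$. -}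

module Defs where

open import Level using (0ℓ)
open import Data.Nat using (ℕ)
open import Data.Fin using (Fin)
open import Data.Sum using (_⊎_; inj₁; inj₂)
open import Data.Product using (Σ; ∃; _×_; _,_)
open import Relation.Nullary using (¬_)
open import Relation.Binary.PropositionalEquality using (_≡_; _≢_)
open import Relation.Binary.Lattice.Structures using (IsBoundedLattice)
open import Function.Bundles using (_↔_)

record FiniteLattice : Set₁ where
  field
    Carrier : Set
    _≤_     : Carrier → Carrier → Set
    _∨_     : Carrier → Carrier → Carrier
    _∧_     : Carrier → Carrier → Carrier
    ⊤       : Carrier
    ⊥       : Carrier
    isBoundedLattice : IsBoundedLattice _≡_ _≤_ _∨_ _∧_ ⊤ ⊥
    size    : ℕ
    finite  : Carrier ↔ Fin size

module _ {A : Set} (_≤_ : A → A → Set) where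

  Covers : A → A → Set
  Covers x y = (x ≤ y) × (x ≢ y) × (∀ z → x ≤ z → z ≤ y → z ≡ x ⊎ z ≡ y)

  IsSup : (A → Set) → A → Set
  IsSup S s = (∀ x → S x → x ≤ s) × (∀ u → (∀ x → S x → x ≤ u) → s ≤ u)

  record IsTNorm (top : A) (T : A → A → A) : Set where
    field
      monoˡ : ∀ a x y → x ≤ y → T x a ≤ T y a
      monoʳ : ∀ a x y → x ≤ y → T a x ≤ T a y
      comm  : ∀ x y → T x y ≡ T y x
      assoc : ∀ x y z → T (T x y) z ≡ T x (T y z)
      identityʳ : ∀ x → T x top ≡ x

  -- left-semicontinuity: T(a, ⋁S) = ⋁_{x∈S} T(a,x) whenever ⋁S ≠ top
  -- (in a complete lattice every S has a supremum, so we quantify over it)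
  LeftSemicontinuous : (top : A) (T : A → A → A) → Set₁
  LeftSemicontinuous top T =
    ∀ (a : A) (S : A → Set) (s : A) → IsSup S s → s ≢ top →
    IsSup (λ y → ∃ λ x → S x × (y ≡ T a x)) (T a s)

module _ (L : FiniteLattice) where
  open FiniteLattice L

  IsAtom : Carrier → Set
  IsAtom p = Covers _≤_ ⊥ p

  IsJoinIrr : Carrier → Set
  IsJoinIrr p = (p ≢ ⊥) × (∀ x y → (x ∨ y) ≡ p → x ≡ p ⊎ y ≡ p)

  IsH : Carrier → Set
  IsH p = IsJoinIrr p × ¬ IsAtom p

  -- An indexing of H(L): a type W with an injective map w onto H(L).
  -- The element of W indexed by i plays the role of the new atom w_{w i}.
  record HIndex : Set₁ where
    field
      W      : Set
      elt    : W → Carrier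
      elt-injective : ∀ i j → elt i ≡ elt j → i ≡ j
      elt-H  : ∀ i → IsH (elt i)
      elt-onto : ∀ p → IsH p → ∃ λ i → elt i ≡ p

  -- The lattice L̃ : carrier L ⊎ W, with new elements 0 ≺ w_p ≺ p.
  module Tilde (I : HIndex) where
    open HIndex I

    LT : Set
    LT = Carrier ⊎ W

    _≤̃_ : LT → LT → Set
    inj₁ x ≤̃ inj₁ y = x ≤ y
    inj₂ i ≤̃ inj₁ y = elt i ≤ y
    inj₁ x ≤̃ inj₂ j = x ≡ ⊥
    inj₂ i ≤̃ inj₂ j = i ≡ j

    ⊤̃ : LT
    ⊤̃ = inj₁ ⊤

-- Suprema of subsets of L are also suprema in L̃: an upper bound w_p of
-- S ⊆ L forces S ⊆ {0}, so ⋁S = 0 ≤ w_p.  So left-semicontinuity of T' at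
-- a ∈ L and S ⊆ L yields ⋁ T'(a, S) = T(a, ⋁S) in L̃, and as the order of L̃
-- extends that of L this supremum is also one in L.
module Submission where

open import Defs
open import Data.Sum using (inj₁; inj₂)
open import Data.Sum.Properties using (inj₁-injective)
open import Data.Product using (∃; _×_; _,_)
open import Function using (_∘_)
open import Relation.Unary using (_≐_)
open import Relation.Unary.Properties using (≐-sym; ≐-trans)
open import Relation.Binary.PropositionalEquality using (_≡_; refl; sym; subst)
open import Relation.Binary.Lattice.Structures using (IsBoundedLattice)

Image : {A B : Set} → (A → B) → (A → Set) → (B → Set)
Image f S y = ∃ λ x → S x × (y ≡ f x)

image-∘ : {A B C : Set} (g : B → C) (f : A → B) (S : A → Set) →
  Image g (Image f S) ≐ Image (g ∘ f) S
image-∘ g f S = (λ { (_ , (x , Sx , refl) , refl) → x , Sx , refl })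
              , (λ { (x , Sx , refl) → f x , (x , Sx , refl) , refl })

image-cong : {A B : Set} {f g : A → B} (S : A → Set) →
  (∀ x → f x ≡ g x) → Image f S ≐ Image g S
image-cong S f≗g = (λ { (x , Sx , refl) → x , Sx , f≗g x })
                 , (λ { (x , Sx , refl) → x , Sx , sym (f≗g x) })

module _ {A : Set} (_≤_ : A → A → Set) where

  IsSup-resp-≐ : ∀ {S S′ s} → S ≐ S′ → IsSup _≤_ S s → IsSup _≤_ S′ s
  IsSup-resp-≐ (S⊆S′ , S′⊆S) (ub , least) =
    (λ x S′x → ub x (S′⊆S S′x)) , (λ u ub′ → least u (λ x Sx → ub′ x (S⊆S′ Sx)))

module _ {A B : Set} (_≤ᴬ_ : A → A → Set) (_≤ᴮ_ : B → B → Set) (f : B → A)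
         (mono : ∀ {x y} → x ≤ᴮ y → f x ≤ᴬ f y)
         (reflects : ∀ {x y} → f x ≤ᴬ f y → x ≤ᴮ y) where

  IsSup-reflect : ∀ {S s} → IsSup _≤ᴬ_ (Image f S) (f s) → IsSup _≤ᴮ_ S s
  IsSup-reflect (ub , least) =
      (λ x Sx → reflects (ub (f x) (x , Sx , refl)))
    , (λ u ubu → reflects (least (f u) λ { _ (x , Sx , refl) → mono (ubu x Sx) }))

module _ (L : FiniteLattice) (I : HIndex L) where
  open FiniteLattice L
  open Tilde L I
  open IsBoundedLattice isBoundedLattice using (antisym; minimum) renaming (refl to ≤-refl)

  IsSup-inj₁ : ∀ {S s} → IsSup _≤_ S s → IsSup _≤̃_ (Image inj₁ S) (inj₁ s)
  IsSup-inj₁ {S} {s} (ub , least) = (λ { _ (x , Sx , refl) → ub x Sx }) , least̃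
    where
    least̃ : ∀ u → (∀ z → Image inj₁ S z → z ≤̃ u) → inj₁ s ≤̃ u
    least̃ (inj₁ y) ubu = least y (λ x Sx → ubu (inj₁ x) (x , Sx , refl))
    least̃ (inj₂ _) ubw = antisym (least ⊥ ⊥-ub) (minimum s)
      where
      ⊥-ub : ∀ x → S x → x ≤ ⊥
      ⊥-ub x Sx = subst (x ≤_) (ubw (inj₁ x) (x , Sx , refl)) ≤-refl

theorem6p6 : (L : FiniteLattice) (I : HIndex L) →
    let open FiniteLattice L in
    let open Tilde L I in
    (T' : LT → LT → LT) →
    IsTNorm _≤̃_ ⊤̃ T' →
    LeftSemicontinuous _≤̃_ ⊤̃ T' →
    (T : Carrier → Carrier → Carrier) →
    (∀ x y → T' (inj₁ x) (inj₁ y) ≡ inj₁ (T x y)) →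
    IsTNorm _≤_ ⊤ T →
    LeftSemicontinuous _≤_ ⊤ T
theorem6p6 L I T' _ lsc′ T restricts _ a S s sup-s s≢⊤ =
  IsSup-reflect _≤̃_ _≤_ inj₁ (λ x≤y → x≤y) (λ x≤y → x≤y) sup-image
  where
  open FiniteLattice L
  open Tilde L I

  images-agree : Image (T' (inj₁ a)) (Image inj₁ S) ≐ Image inj₁ (Image (T a) S)
  images-agree =
    ≐-trans (image-∘ (T' (inj₁ a)) inj₁ S)
      (≐-trans (image-cong S (restricts a)) (≐-sym (image-∘ inj₁ (T a) S)))

  sup-image : IsSup _≤̃_ (Image inj₁ (Image (T a) S)) (inj₁ (T a s))
  sup-image = subst (IsSup _≤̃_ _) (restricts a s)
    (IsSup-resp-≐ _≤̃_ images-agree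
      (lsc′ (inj₁ a) (Image inj₁ S) (inj₁ s) (IsSup-inj₁ L I sup-s) (s≢⊤ ∘ inj₁-injective)))
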